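{- Every $P_4$-sparse graph is an OAT graph.
   Context: All graphs are finite and simple. A graph is $P_4$-sparse if for every set of 5 vertices, at most one induced subgraph on a subset of these vertices is isomorphic to $P_4$ (the path on 4 vertices), i.e. every 5 vertices contain at most one induced $P_4$. For non-adjacent vertices $u,v$, $u$ is comparable to $v$ if $N(u)\subseteq N(v)$. A graph is an OAT graph if it can be constructed from single-vertex graphs by a finite sequence of the following operations, where $G_1=(V_1,E_1)$, $G_2=(V_2,E_2)$ are vertex-disjoint OAT graphs: (1) disjoint union $(V_1\cup V_2,E_1\cup E_2)$; (2) join $(V_1\cup V_2, E_1\cup E_2\cup\{xy: x\in V_1,y\in V_2\})$; (3) adding a comparable vertex: for $v\in V_1$ and a new vertex $u\notin V_1$, form $(V_1\cup\{u\}, E_1\cup\{ux: x\in X\})$ for some $X\subseteq N(v)$; (4) attaching a clique: for a complete graph $Q=(V_Q,E_Q)$ disjoint from $G_1$ and $v\in V_1$, form $(V_1\cup V_Q, E_1\cup E_Q\cup\{qv: q\in V_Q\})$. -}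

module Defs where

open import Data.Nat using (ℕ; zero; suc; _+_)
open import Data.Fin using (Fin; zero; suc; splitAt; _≟_)
open import Data.Bool using (Bool; true; false; not)
open import Data.Sum using (_⊎_; inj₁; inj₂)
open import Data.Product using (_×_; _,_)
open import Relation.Nullary using (¬_; does)
open import Relation.Binary.PropositionalEquality using (_≡_; refl; sym)
open import Function.Bundles using (_↔_; Inverse)
open import Function.Definitions using (Injective)

record Graph (n : ℕ) : Set where
  field
    adj     : Fin n → Fin n → Bool
    adj-sym : ∀ x y → adj x y ≡ adj y x
    adj-irr : ∀ x → adj x x ≡ false

open Graph public

Edge : ∀ {n} → Graph n → Fin n → Fin n → Set
Edge G x y = adj G x y ≡ true

record _≅_ {m n : ℕ} (G : Graph m) (H : Graph n) : Set where
  field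
    bij      : Fin m ↔ Fin n
    preserve : ∀ x y → adj H (Inverse.to bij x) (Inverse.to bij y) ≡ adj G x y

-- a - b - c - d is an induced path on 4 vertices
-- (distinctness of a,b,c,d follows from the (non-)edges and irreflexivity)
InducedP4 : ∀ {n} → Graph n → Fin n → Fin n → Fin n → Fin n → Set
InducedP4 G a b c d =
  Edge G a b × Edge G b c × Edge G c d ×
  ¬ Edge G a c × ¬ Edge G b d × ¬ Edge G a d

_∈₄_ : ∀ {k} → Fin k → (Fin k × Fin k × Fin k × Fin k) → Set
x ∈₄ (a , b , c , d) = (x ≡ a) ⊎ (x ≡ b) ⊎ (x ≡ c) ⊎ (x ≡ d)

-- Every 5 vertices (given by an injective map f : Fin 5 → Fin n) contain
-- at most one induced P4: any two 4-subsets of these 5 vertices that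
-- induce a P4 are the same vertex set.
P4Sparse : ∀ {n} → Graph n → Set
P4Sparse {n} G =
  (f : Fin 5 → Fin n) → Injective _≡_ _≡_ f →
  (a b c d a' b' c' d' : Fin 5) →
  InducedP4 G (f a) (f b) (f c) (f d) →
  InducedP4 G (f a') (f b') (f c') (f d') →
  ∀ x → (x ∈₄ (a , b , c , d) → x ∈₄ (a' , b' , c' , d'))
      × (x ∈₄ (a' , b' , c' , d') → x ∈₄ (a , b , c , d))

K1 : Graph 1
K1 = record { adj = λ _ _ → false ; adj-sym = λ _ _ → refl ; adj-irr = λ _ → refl }

complete : (k : ℕ) → Graph k
complete k = record
  { adj = λ x y → not (does (x ≟ y))
  ; adj-sym = λ x y → sym-≠ x y
  ; adj-irr = irr
  }
  where
  sym-≠ : ∀ (x y : Fin k) → not (does (x ≟ y)) ≡ not (does (y ≟ x))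
  sym-≠ x y with x ≟ y | y ≟ x
  ... | Relation.Nullary.yes _ | Relation.Nullary.yes _ = refl
  ... | Relation.Nullary.no _  | Relation.Nullary.no _  = refl
  ... | Relation.Nullary.yes p | Relation.Nullary.no q  with q (sym p)
  ... | ()
  sym-≠ x y | Relation.Nullary.no q | Relation.Nullary.yes p with q (sym p)
  ... | ()
  irr : ∀ (x : Fin k) → not (does (x ≟ x)) ≡ false
  irr x with x ≟ x
  ... | Relation.Nullary.yes _ = refl
  ... | Relation.Nullary.no q with q refl
  ... | ()

sumAdj : ∀ {m k} → Graph m → Graph k → (Fin m → Fin k → Bool) →
         Fin m ⊎ Fin k → Fin m ⊎ Fin k → Bool
sumAdj G H cross (inj₁ x) (inj₁ y) = adj G x y
sumAdj G H cross (inj₁ x) (inj₂ y) = cross x y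
sumAdj G H cross (inj₂ x) (inj₁ y) = cross y x
sumAdj G H cross (inj₂ x) (inj₂ y) = adj H x y

sumAdj-sym : ∀ {m k} (G : Graph m) (H : Graph k) cross (x y : Fin m ⊎ Fin k) →
             sumAdj G H cross x y ≡ sumAdj G H cross y x
sumAdj-sym G H cross (inj₁ x) (inj₁ y) = adj-sym G x y
sumAdj-sym G H cross (inj₁ x) (inj₂ y) = refl
sumAdj-sym G H cross (inj₂ x) (inj₁ y) = refl
sumAdj-sym G H cross (inj₂ x) (inj₂ y) = adj-sym H x y

sumAdj-irr : ∀ {m k} (G : Graph m) (H : Graph k) cross (x : Fin m ⊎ Fin k) →
             sumAdj G H cross x x ≡ false
sumAdj-irr G H cross (inj₁ x) = adj-irr G x
sumAdj-irr G H cross (inj₂ x) = adj-irr H x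

glue : ∀ {m k} → Graph m → Graph k → (Fin m → Fin k → Bool) → Graph (m + k)
glue {m} G H cross = record
  { adj = λ x y → sumAdj G H cross (splitAt m x) (splitAt m y)
  ; adj-sym = λ x y → sumAdj-sym G H cross (splitAt m x) (splitAt m y)
  ; adj-irr = λ x → sumAdj-irr G H cross (splitAt m x)
  }

disjointUnion : ∀ {m k} → Graph m → Graph k → Graph (m + k)
disjointUnion G H = glue G H (λ _ _ → false)

join : ∀ {m k} → Graph m → Graph k → Graph (m + k)
join G H = glue G H (λ _ _ → true)

attachClique : ∀ {n} → Graph n → Fin n → (k : ℕ) → Graph (n + k)
attachClique G v k = glue G (complete k) (λ x _ → does (x ≟ v))

-- (3) adding a new vertex u (vertex zero) adjacent exactly to the
-- vertices in X (given as a characteristic function, old vertices are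
-- suc x); the side condition X ⊆ N(v) is imposed in the OAT constructor.
addVertexAdj : ∀ {n} → Graph n → (Fin n → Bool) → Fin (suc n) → Fin (suc n) → Bool
addVertexAdj G X zero    zero    = false
addVertexAdj G X zero    (suc y) = X y
addVertexAdj G X (suc x) zero    = X x
addVertexAdj G X (suc x) (suc y) = adj G x y

addVertexAdj-sym : ∀ {n} (G : Graph n) X (x y : Fin (suc n)) →
                   addVertexAdj G X x y ≡ addVertexAdj G X y x
addVertexAdj-sym G X zero    zero    = refl
addVertexAdj-sym G X zero    (suc y) = refl
addVertexAdj-sym G X (suc x) zero    = refl
addVertexAdj-sym G X (suc x) (suc y) = adj-sym G x y

addVertexAdj-irr : ∀ {n} (G : Graph n) X (x : Fin (suc n)) → addVertexAdj G X x x ≡ false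
addVertexAdj-irr G X zero    = refl
addVertexAdj-irr G X (suc x) = adj-irr G x

addVertex : ∀ {n} → Graph n → (Fin n → Bool) → Graph (suc n)
addVertex G X = record
  { adj = addVertexAdj G X
  ; adj-sym = addVertexAdj-sym G X
  ; adj-irr = addVertexAdj-irr G X
  }

data OAT : ∀ {n} → Graph n → Set where
  single     : OAT K1
  union      : ∀ {m k} {G : Graph m} {H : Graph k} → OAT G → OAT H →
               OAT (disjointUnion G H)
  joined     : ∀ {m k} {G : Graph m} {H : Graph k} → OAT G → OAT H →
               OAT (join G H)
  comparable : ∀ {n} {G : Graph n} → OAT G → (v : Fin n) (X : Fin n → Bool) →
               (∀ x → X x ≡ true → Edge G v x) →
               OAT (addVertex G X)
  clique     : ∀ {n} {G : Graph n} → OAT G → (v : Fin n) (k : ℕ) →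
               OAT (attachClique G v k)
  iso        : ∀ {m n} {G : Graph m} {H : Graph n} → OAT G → G ≅ H → OAT H

module Submission where

-- Strong induction on the number of vertices; a single vertex is K1.
-- If G contains an induced P4 a-b-c-d, P4-sparseness forces N(a) ⊆ N(c)
-- (any neighbour w of a outside N(c) would create a second induced P4 on
-- {a,b,c,d,w}).  Hence G is obtained from G - a by adding the vertex a,
-- comparable to c (operation 3).  If G has no induced P4, then G (on at
-- least two vertices) has a "split": a partition of the vertices into two
-- non-empty sides with all cross pairs adjacent or all non-adjacent (the
-- classical fact that a P4-free graph or its complement is disconnected,
-- proved here by adding one vertex at a time).  Then G is the disjoint
-- union or the join (operations 1, 2) of the two sides, which are smaller
-- P4-sparse induced subgraphs.

open import Data.Nat using (ℕ; zero; suc; _+_; _≤_; _<_)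
open import Data.Nat.Properties using (+-suc; +-comm; m≤m+n; suc-injective; ≤-refl)
open import Data.Nat.Induction using (<-rec)
open import Induction.WellFounded using (WfRec)
open import Data.Fin using (Fin; zero; suc; splitAt; punchIn; punchOut) renaming (_≟_ to _≟F_; join to joinFin)
open import Data.Fin.Properties using (any?; splitAt-join; join-splitAt; punchIn-punchOut; punchOut-punchIn; punchInᵢ≢i; punchIn-injective; punchOut-cong)
  renaming (suc-injective to Fin-suc-injective)
open import Data.Vec.Functional using (Vector; []; _∷_)
open import Data.Bool using (Bool; true; false; not; _∧_) renaming (_≟_ to _≟B_)
open import Data.Bool.Properties using (not-involutive; not-¬; ¬-not; ∧-zeroʳ; ∧-identityʳ)
open import Data.Sum using (_⊎_; inj₁; inj₂) renaming (map to ⊎-map)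
open import Data.Sum.Properties using (inj₁-injective; inj₂-injective)
open import Data.Product using (_×_; _,_; Σ; ∃; proj₂)
open import Data.Empty using (⊥; ⊥-elim)
open import Relation.Nullary using (¬_; Dec; yes; no)
open import Relation.Nullary.Decidable using (_×-dec_; ¬?; dec-false)
open import Relation.Binary.PropositionalEquality using (_≡_; _≢_; refl; sym; trans; cong; cong₂; subst)
open import Function.Bundles using (mk↔ₛ′)
open import Function.Definitions using (Injective)
open import Defs

not-flip : ∀ {x b} → not x ≡ b → x ≡ not b
not-flip {x} e = trans (sym (not-involutive x)) (cong not e)

module _ {N : ℕ} (G : Graph N) where

  flip : ∀ {x y b} → adj G x y ≡ b → adj G y x ≡ b
  flip {x} {y} e = trans (adj-sym G y x) e

  nonEdge : ∀ {x y} → adj G x y ≡ false → ¬ Edge G x y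
  nonEdge = not-¬

  flip¬ : ∀ {x y} → ¬ Edge G x y → ¬ Edge G y x
  flip¬ h e = h (flip e)

  edge≢ : ∀ {x y} → Edge G x y → x ≢ y
  edge≢ {x} e refl = not-¬ (adj-irr G x) e

  separates : ∀ {z x y} → adj G z x ≡ true → adj G z y ≡ false → x ≢ y
  separates e f refl = not-¬ f e

-- The non-consecutive vertices of an induced P4 are distinct: each pair
-- is separated by a third vertex of the path.
module _ {N} (G : Graph N) {a b c d : Fin N} where

  P4-a≢c : InducedP4 G a b c d → a ≢ c
  P4-a≢c (_ , _ , cd , _ , _ , ¬ad) e = separates G (flip G cd) (flip G (¬-not ¬ad)) (sym e)

  P4-b≢d : InducedP4 G a b c d → b ≢ d
  P4-b≢d (ab , _ , _ , _ , _ , ¬ad) = separates G ab (¬-not ¬ad)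

  P4-a≢d : InducedP4 G a b c d → a ≢ d
  P4-a≢d (ab , _ , _ , _ , ¬bd , _) = separates G (flip G ab) (¬-not ¬bd)

NoP4 : ∀ {N} → Graph N → Set
NoP4 G = ∀ a b c d → ¬ InducedP4 G a b c d

findP4 : ∀ {N} (G : Graph N) → Dec (∃ λ a → ∃ λ b → ∃ λ c → ∃ λ d → InducedP4 G a b c d)
findP4 G = any? λ a → any? λ b → any? λ c → any? λ d → isP4? a b c d
  where
  edge? : ∀ x y → Dec (Edge G x y)
  edge? x y = adj G x y ≟B true
  isP4? : ∀ a b c d → Dec (InducedP4 G a b c d)
  isP4? a b c d = edge? a b ×-dec edge? b c ×-dec edge? c d ×-dec
                  ¬? (edge? a c) ×-dec ¬? (edge? b d) ×-dec ¬? (edge? a d)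

induced : ∀ {N m} → Graph N → (Fin m → Fin N) → Graph m
induced G g = record
  { adj = λ x y → adj G (g x) (g y)
  ; adj-sym = λ x y → adj-sym G (g x) (g y)
  ; adj-irr = λ x → adj-irr G (g x) }

_─_ : ∀ {N} → Graph (suc N) → Fin (suc N) → Graph N
G ─ u = induced G (punchIn u)

induced-P4Sparse : ∀ {N m} (G : Graph N) (g : Fin m → Fin N) →
  Injective _≡_ _≡_ g → P4Sparse G → P4Sparse (induced G g)
induced-P4Sparse G g g-inj sp f f-inj = sp (λ i → g (f i)) (λ e → f-inj (g-inj e))

induced-NoP4 : ∀ {N m} (G : Graph N) (g : Fin m → Fin N) → NoP4 G → NoP4 (induced G g)
induced-NoP4 G g np a b c d = np (g a) (g b) (g c) (g d)

-- The complement, built from the complete graph so that it stays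
-- irreflexive.
complement : ∀ {N} → Graph N → Graph N
complement {N} G = record
  { adj = λ x y → not (adj G x y) ∧ adj (complete N) x y
  ; adj-sym = λ x y → cong₂ _∧_ (cong not (adj-sym G x y)) (adj-sym (complete N) x y)
  ; adj-irr = λ x → trans (cong (not (adj G x x) ∧_) (adj-irr (complete N) x)) (∧-zeroʳ _) }

record Complementary {N} (G H : Graph N) : Set where
  constructor complementary
  field
    negates : ∀ {x y} → x ≢ y → adj H x y ≡ not (adj G x y)

open Complementary

complement-complementary : ∀ {N} (G : Graph N) → Complementary G (complement G)
complement-complementary G = complementary λ {x} {y} x≢y →
  trans (cong (λ c → not (adj G x y) ∧ not c) (dec-false (x ≟F y) x≢y)) (∧-identityʳ _)

complementary-sym : ∀ {N} {G H : Graph N} → Complementary G H → Complementary H G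
complementary-sym c = complementary λ x≢y → not-flip (sym (negates c x≢y))

induced-complementary : ∀ {N m} {G H : Graph N} (g : Fin m → Fin N) →
  Injective _≡_ _≡_ g → Complementary G H → Complementary (induced G g) (induced H g)
induced-complementary g g-inj c = complementary λ x≢y → negates c (λ e → x≢y (g-inj e))

-- P4 is self-complementary: a P4 a-b-c-d of H is the P4 c-a-d-b of G.
complementary-NoP4 : ∀ {N} {G H : Graph N} → Complementary G H → NoP4 G → NoP4 H
complementary-NoP4 {G = G} {H} c np a b c' d P@(ab , bc , cd , ¬ac , ¬bd , ¬ad) =
  np c' a d b ( flip G (present ¬ac (P4-a≢c H P)) , present ¬ad (P4-a≢d H P) , flip G (present ¬bd (P4-b≢d H P))
              , nonEdge G (absent cd) , nonEdge G (absent ab) , nonEdge G (flip G (absent bc)) )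
  where
  present : ∀ {x y} → ¬ Edge H x y → x ≢ y → Edge G x y
  present h x≢y = not-flip (trans (sym (negates c x≢y)) (¬-not h))
  absent : ∀ {x y} → Edge H x y → adj G x y ≡ false
  absent e = not-flip (trans (sym (negates c (edge≢ H e))) e)

∷-injective : ∀ {A : Set} {n} {x : A} (f : Vector A n) →
  Injective _≡_ _≡_ f → (∀ i → x ≢ f i) → Injective _≡_ _≡_ (x ∷ f)
∷-injective f f-inj fresh {zero}  {zero}  _ = refl
∷-injective f f-inj fresh {zero}  {suc j} e = ⊥-elim (fresh j e)
∷-injective f f-inj fresh {suc i} {zero}  e = ⊥-elim (fresh i (sym e))
∷-injective f f-inj fresh {suc i} {suc j} e = cong suc (f-inj e)

[]-injective : ∀ {A : Set} → Injective _≡_ _≡_ ([] {A = A})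
[]-injective {x = ()}

endpoint-comparable : ∀ {N} (G : Graph N) → P4Sparse G → ∀ {a b c d} →
  InducedP4 G a b c d → ∀ w → Edge G a w → Edge G c w
endpoint-comparable {N} G sp {a} {b} {c} {d} P@(ab , bc , cd , ¬ac , ¬bd , ¬ad) w aw
  with w ≟F b
... | yes refl = flip G bc
... | no w≢b = ¬-not impossible
  where
  w≢c : w ≢ c
  w≢c = separates G aw (¬-not ¬ac)
  w≢d : w ≢ d
  w≢d = separates G aw (¬-not ¬ad)

  five : Vector (Fin N) 5
  five = a ∷ b ∷ c ∷ d ∷ w ∷ []

  five-injective : Injective _≡_ _≡_ five
  five-injective =
    ∷-injective _ (∷-injective _ (∷-injective _ (∷-injective _ (∷-injective _ []-injective
      (λ ()))
      (λ { zero e → w≢d (sym e) }))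
      (λ { zero e → edge≢ G cd e ; (suc zero) e → w≢c (sym e) }))
      (λ { zero e → edge≢ G bc e ; (suc zero) e → P4-b≢d G P e
         ; (suc (suc zero)) e → w≢b (sym e) }))
      (λ { zero e → edge≢ G ab e ; (suc zero) e → P4-a≢c G P e
         ; (suc (suc zero)) e → P4-a≢d G P e
         ; (suc (suc (suc zero))) e → edge≢ G aw e })

  w-index : Fin 5
  w-index = suc (suc (suc (suc zero)))

  -- Any induced P4 among the five vertices through w contradicts sparseness,
  -- since a-b-c-d (indices 0..3) is already one and does not contain w.
  noP4Through-w : ∀ i j k l →
    InducedP4 G (five i) (five j) (five k) (five l) → w-index ∈₄ (i , j , k , l) → ⊥
  noP4Through-w i j k l Q w∈ with proj₂ (sp five five-injective zero (suc zero) (suc (suc zero))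
                                   (suc (suc (suc zero))) i j k l P Q w-index) w∈
  ... | inj₁ ()
  ... | inj₂ (inj₁ ())
  ... | inj₂ (inj₂ (inj₁ ()))
  ... | inj₂ (inj₂ (inj₂ ()))

  -- If w ∉ N(c), the adjacencies of w to b and d produce such a P4.
  impossible : adj G c w ≡ false → ⊥
  impossible cw with adj G b w in bw | adj G d w in dw
  ... | false | false = noP4Through-w w-index zero (suc zero) (suc (suc zero))
        (flip G aw , ab , bc , nonEdge G (flip G bw) , ¬ac , nonEdge G (flip G cw)) (inj₁ refl)
  ... | true | false = noP4Through-w w-index (suc zero) (suc (suc zero)) (suc (suc (suc zero)))
        (flip G bw , bc , cd , nonEdge G (flip G cw) , ¬bd , nonEdge G (flip G dw)) (inj₁ refl)
  ... | false | true = noP4Through-w (suc zero) zero w-index (suc (suc (suc zero)))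
        (flip G ab , aw , flip G dw , nonEdge G bw , ¬ad , ¬bd) (inj₂ (inj₂ (inj₁ refl)))
  ... | true | true = noP4Through-w (suc (suc zero)) (suc (suc (suc zero))) w-index zero
        (cd , dw , flip G aw , nonEdge G cw , flip¬ G ¬ad , flip¬ G ¬ac) (inj₂ (inj₂ (inj₁ refl)))

neighbourhood : ∀ {N} (G : Graph (suc N)) (u : Fin (suc N)) → Fin N → Bool
neighbourhood G u y = adj G u (punchIn u y)

deletion-iso : ∀ {N} (G : Graph (suc N)) (u : Fin (suc N)) →
  addVertex (G ─ u) (neighbourhood G u) ≅ G
deletion-iso {N} G u = record { bij = mk↔ₛ′ to from to-from from-to ; preserve = preserve }
  where
  to : Fin (suc N) → Fin (suc N)
  to zero    = u
  to (suc y) = punchIn u y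
  from′ : ∀ w → Dec (u ≡ w) → Fin (suc N)
  from′ w (yes _)  = zero
  from′ w (no u≢w) = suc (punchOut u≢w)
  from : Fin (suc N) → Fin (suc N)
  from w = from′ w (u ≟F w)
  to-from : ∀ w → to (from w) ≡ w
  to-from w with u ≟F w
  ... | yes u≡w = u≡w
  ... | no u≢w  = punchIn-punchOut u≢w
  from-to : ∀ x → from (to x) ≡ x
  from-to zero with u ≟F u
  ... | yes _  = refl
  ... | no u≢u = ⊥-elim (u≢u refl)
  from-to (suc y) with u ≟F punchIn u y
  ... | yes u≡ = ⊥-elim (punchInᵢ≢i u y (sym u≡))
  ... | no u≢  = cong suc (trans (punchOut-cong u refl) (punchOut-punchIn u))
  preserve : ∀ x y → adj G (to x) (to y) ≡ addVertexAdj (G ─ u) (neighbourhood G u) x y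
  preserve zero    zero    = adj-irr G u
  preserve zero    (suc y) = refl
  preserve (suc x) zero    = adj-sym G (punchIn u x) u
  preserve (suc x) (suc y) = refl

record Split {N} (G : Graph N) (b : Bool) : Set where
  constructor mkSplit
  field
    side    : Fin N → Bool
    inside  : ∃ λ x → side x ≡ true
    outside : ∃ λ y → side y ≡ false
    cross   : ∀ x y → side x ≡ true → side y ≡ false → adj G x y ≡ b

  across : ∀ x y → side x ≢ side y → adj G x y ≡ b
  across x y ne with side x in sx | side y in sy
  ... | true  | false = cross x y sx sy
  ... | false | true  = flip G (cross y x sy sx)
  ... | true  | true  = ⊥-elim (ne refl)
  ... | false | false = ⊥-elim (ne refl)

swap : ∀ {N} {G : Graph N} {b} → Split G b → Split G b
swap {G = G} (mkSplit side (x , sx) (y , sy) cross) =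
  mkSplit (λ v → not (side v)) (y , cong not sy) (x , cong not sx)
    (λ u v su sv → flip G (cross v u (not-flip sv) (not-flip su)))

-- A split of G is a split of any complementary graph, with the opposite
-- cross value (vertices on different sides are distinct).
complementary-split : ∀ {N} {G H : Graph N} {b} → Complementary G H → Split G b → Split H (not b)
complementary-split c (mkSplit side inside outside cross) =
  mkSplit side inside outside λ x y sx sy →
    trans (negates c (λ { refl → not-¬ sx sy })) (cong not (cross x y sx sy))

-- Extending a disconnected split (b = false) of G - 0 to a split of a
-- P4-free graph G, by cases on the neighbours of the vertex 0.
module Extension {N} (G : Graph (suc N)) (np : NoP4 G) where

  sees : Fin N → Bool
  sees y = adj G zero (suc y)

  blind-to-inside : (s : Split (G ─ zero) false) →
    (∀ y → Split.side s y ≡ true → sees y ≡ false) → Split G false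
  blind-to-inside (mkSplit side (x , sx) _ cross) blind =
    mkSplit side′ (suc x , sx) (zero , refl) cross′
    where
    side′ : Fin (suc N) → Bool
    side′ zero    = false
    side′ (suc y) = side y
    cross′ : ∀ u v → side′ u ≡ true → side′ v ≡ false → adj G u v ≡ false
    cross′ (suc u) zero    su _  = flip G (blind u su)
    cross′ (suc u) (suc v) su sv = cross u v su sv

  dominating : (∀ y → sees y ≡ true) → Fin N → Split G true
  dominating all y = mkSplit side′ (zero , refl) (suc y , refl) cross′
    where
    side′ : Fin (suc N) → Bool
    side′ zero    = true
    side′ (suc _) = false
    cross′ : ∀ u v → side′ u ≡ true → side′ v ≡ false → adj G u v ≡ true
    cross′ zero (suc v) _ _ = all v

  -- If 0 sees vertices on both sides and misses some vertex y₀, the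
  -- non-neighbours of 0 are separated from 0 and its neighbours: an edge
  -- from a non-neighbour u to a neighbour w on the same side as u would
  -- give the induced P4 u-w-0-z with z a neighbour of 0 on the other side.
  sees-both : (s : Split (G ─ zero) false) →
    (∀ x → ∃ λ z → sees z ≡ true × Split.side s z ≢ Split.side s x) →
    ∀ y₀ → sees y₀ ≡ false → Split G false
  sees-both s other y₀ y₀-unseen = mkSplit side′ (suc y₀ , cong not y₀-unseen) (zero , refl) cross′
    where
    open Split s using (side; across)
    side′ : Fin (suc N) → Bool
    side′ zero    = false
    side′ (suc y) = not (sees y)
    unseen-seen : ∀ u w → sees u ≡ false → sees w ≡ true → adj G (suc u) (suc w) ≡ false
    unseen-seen u w su sw with side u ≟B side w | other u
    ... | no differ    | _ = across u w differ
    ... | yes same | z , sz , z-other = ¬-not λ uw →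
          np (suc u) (suc w) zero (suc z)
             ( uw , flip G sw , sz , nonEdge G (flip G su)
             , nonEdge G (across w z λ e → z-other (sym (trans same e)))
             , nonEdge G (across u z λ e → z-other (sym e)) )
    cross′ : ∀ u v → side′ u ≡ true → side′ v ≡ false → adj G u v ≡ false
    cross′ (suc u) zero    su _  = flip G (not-flip su)
    cross′ (suc u) (suc v) su sv = unseen-seen u v (not-flip su) (not-flip sv)

  extend : Split (G ─ zero) false → Σ Bool (Split G)
  extend s with any? (λ y → (Split.side s y ≟B true) ×-dec (sees y ≟B true))
  ... | no none-inside = false , blind-to-inside s λ y sy → ¬-not λ e → none-inside (y , sy , e)
  ... | yes (y₁ , in₁ , seen₁) with any? (λ y → (Split.side s y ≟B false) ×-dec (sees y ≟B true))
  ...   | no none-outside = false , blind-to-inside (swap s) λ y sy → ¬-not λ e → none-outside (y , not-flip sy , e)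
  ...   | yes (y₂ , out₂ , seen₂) with any? (λ y → sees y ≟B false)
  ...     | no misses-none = true , dominating (λ y → ¬-not λ e → misses-none (y , e)) y₁
  ...     | yes (y₀ , unseen₀) = false , sees-both s other y₀ unseen₀
    where
    other : ∀ x → ∃ λ z → sees z ≡ true × Split.side s z ≢ Split.side s x
    other x with Split.side s x
    ... | true  = y₂ , seen₂ , not-¬ out₂
    ... | false = y₁ , seen₁ , not-¬ in₁

-- Induction adds vertex 0 to a split of
-- G - 0; a join-split of G - 0 is a disconnected split of the complement,
-- which is again P4-free, so Extension handles both cases.
P4-free-split : ∀ N (G : Graph (suc (suc N))) → NoP4 G → Σ Bool (Split G)
P4-free-split zero G np = adj G zero (suc zero) , mkSplit side (zero , refl) (suc zero , refl) cross
  where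
  side : Fin 2 → Bool
  side zero    = true
  side (suc _) = false
  cross : ∀ x y → side x ≡ true → side y ≡ false → adj G x y ≡ adj G zero (suc zero)
  cross zero (suc zero) _ _ = refl
P4-free-split (suc N) G np with P4-free-split N (G ─ zero) (induced-NoP4 G suc np)
... | false , s = Extension.extend G np s
... | true  , s = back-to-G (Extension.extend (complement G) (complementary-NoP4 c np)
                    (complementary-split (induced-complementary suc Fin-suc-injective c) s))
  where
  c : Complementary G (complement G)
  c = complement-complementary G
  back-to-G : Σ Bool (Split (complement G)) → Σ Bool (Split G)
  back-to-G (b , s′) = not b , complementary-split (complementary-sym c) s′

record Partition {N} (p : Fin N → Bool) : Set where
  constructor mkPartition
  field
    m k          : ℕ
    index        : Fin N → Fin m ⊎ Fin k
    vertex       : Fin m ⊎ Fin k → Fin N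
    vertex-index : ∀ x → vertex (index x) ≡ x
    index-vertex : ∀ z → index (vertex z) ≡ z
    left-true    : ∀ i → p (vertex (inj₁ i)) ≡ true
    right-false  : ∀ j → p (vertex (inj₂ j)) ≡ false
    size         : m + k ≡ N

  vertex-injective : Injective _≡_ _≡_ vertex
  vertex-injective {u} {v} e = trans (sym (index-vertex u)) (trans (cong index e) (index-vertex v))

  true-index : ∀ x → p x ≡ true → Fin m
  true-index x px with index x | vertex-index x
  ... | inj₁ i | _  = i
  ... | inj₂ j | eq = ⊥-elim (not-¬ (right-false j) (trans (cong p eq) px))

  false-index : ∀ x → p x ≡ false → Fin k
  false-index x px with index x | vertex-index x
  ... | inj₂ j | _  = j
  ... | inj₁ i | eq = ⊥-elim (not-¬ (trans (cong p eq) px) (left-true i))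

add-true : ∀ {N} (p : Fin (suc N) → Bool) → p zero ≡ true →
  Partition (λ x → p (suc x)) → Partition p
add-true p p0 (mkPartition m k index vertex vertex-index index-vertex left-true right-false size) =
  mkPartition (suc m) k index′ vertex′ vertex-index′ index-vertex′ left-true′ right-false (cong suc size)
  where
  index′ : Fin _ → Fin (suc m) ⊎ Fin k
  index′ zero    = inj₁ zero
  index′ (suc x) = ⊎-map suc (λ j → j) (index x)
  vertex′ : Fin (suc m) ⊎ Fin k → Fin _
  vertex′ (inj₁ zero)    = zero
  vertex′ (inj₁ (suc i)) = suc (vertex (inj₁ i))
  vertex′ (inj₂ j)       = suc (vertex (inj₂ j))
  vertex-index′ : ∀ x → vertex′ (index′ x) ≡ x
  vertex-index′ zero = refl
  vertex-index′ (suc x) with index x | vertex-index x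
  ... | inj₁ i | eq = cong suc eq
  ... | inj₂ j | eq = cong suc eq
  index-vertex′ : ∀ z → index′ (vertex′ z) ≡ z
  index-vertex′ (inj₁ zero)    = refl
  index-vertex′ (inj₁ (suc i)) = cong (⊎-map suc (λ j → j)) (index-vertex (inj₁ i))
  index-vertex′ (inj₂ j)       = cong (⊎-map suc (λ j → j)) (index-vertex (inj₂ j))
  left-true′ : ∀ i → p (vertex′ (inj₁ i)) ≡ true
  left-true′ zero    = p0
  left-true′ (suc i) = left-true i

add-false : ∀ {N} (p : Fin (suc N) → Bool) → p zero ≡ false →
  Partition (λ x → p (suc x)) → Partition p
add-false p p0 (mkPartition m k index vertex vertex-index index-vertex left-true right-false size) =
  mkPartition m (suc k) index′ vertex′ vertex-index′ index-vertex′ left-true right-false′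
    (trans (+-suc m k) (cong suc size))
  where
  index′ : Fin _ → Fin m ⊎ Fin (suc k)
  index′ zero    = inj₂ zero
  index′ (suc x) = ⊎-map (λ i → i) suc (index x)
  vertex′ : Fin m ⊎ Fin (suc k) → Fin _
  vertex′ (inj₂ zero)    = zero
  vertex′ (inj₂ (suc j)) = suc (vertex (inj₂ j))
  vertex′ (inj₁ i)       = suc (vertex (inj₁ i))
  vertex-index′ : ∀ x → vertex′ (index′ x) ≡ x
  vertex-index′ zero = refl
  vertex-index′ (suc x) with index x | vertex-index x
  ... | inj₁ i | eq = cong suc eq
  ... | inj₂ j | eq = cong suc eq
  index-vertex′ : ∀ z → index′ (vertex′ z) ≡ z
  index-vertex′ (inj₂ zero)    = refl
  index-vertex′ (inj₂ (suc j)) = cong (⊎-map (λ i → i) suc) (index-vertex (inj₂ j))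
  index-vertex′ (inj₁ i)       = cong (⊎-map (λ i → i) suc) (index-vertex (inj₁ i))
  right-false′ : ∀ j → p (vertex′ (inj₂ j)) ≡ false
  right-false′ zero    = p0
  right-false′ (suc j) = right-false j

partition : ∀ {N} (p : Fin N → Bool) → Partition p
partition {zero} p =
  mkPartition 0 0 (λ ()) (λ { (inj₁ ()) ; (inj₂ ()) }) (λ ()) (λ { (inj₁ ()) ; (inj₂ ()) }) (λ ()) (λ ()) refl
partition {suc N} p with p zero in p0
... | true  = add-true  p p0 (partition (λ x → p (suc x)))
... | false = add-false p p0 (partition (λ x → p (suc x)))

left-part right-part : ∀ {N} (G : Graph N) {p : Fin N → Bool} (P : Partition p) → Graph _
left-part  G P = induced G (λ i → Partition.vertex P (inj₁ i))
right-part G P = induced G (λ j → Partition.vertex P (inj₂ j))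

partition-iso : ∀ {N} (G : Graph N) {p : Fin N → Bool} (P : Partition p) {b : Bool} →
  (∀ x y → p x ≡ true → p y ≡ false → adj G x y ≡ b) →
  glue (left-part G P) (right-part G P) (λ _ _ → b) ≅ G
partition-iso G {p} P@(mkPartition m k index vertex vertex-index index-vertex left-true right-false _) {b} cross =
  record { bij = mk↔ₛ′ to from to-from from-to ; preserve = λ x y → preserve (splitAt m x) (splitAt m y) }
  where
  to : Fin (m + k) → Fin _
  to x = vertex (splitAt m x)
  from : Fin _ → Fin (m + k)
  from y = joinFin m k (index y)
  to-from : ∀ y → to (from y) ≡ y
  to-from y = trans (cong vertex (splitAt-join m k (index y))) (vertex-index y)
  from-to : ∀ x → from (to x) ≡ x
  from-to x = trans (cong (joinFin m k) (index-vertex (splitAt m x))) (join-splitAt m k x)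
  preserve : ∀ u v → adj G (vertex u) (vertex v) ≡ sumAdj (left-part G P) (right-part G P) (λ _ _ → b) u v
  preserve (inj₁ i) (inj₁ j) = refl
  preserve (inj₁ i) (inj₂ j) = cross _ _ (left-true i) (right-false j)
  preserve (inj₂ i) (inj₁ j) = flip G (cross _ _ (left-true j) (right-false i))
  preserve (inj₂ i) (inj₂ j) = refl

IsOAT : ℕ → Set
IsOAT n = (G : Graph (suc n)) → P4Sparse G → OAT G

K1-iso : (G : Graph 1) → K1 ≅ G
K1-iso G = record { bij = mk↔ₛ′ (λ x → x) (λ x → x) (λ _ → refl) (λ _ → refl) ; preserve = irreflexive }
  where
  irreflexive : ∀ x y → adj G x y ≡ false
  irreflexive zero zero = adj-irr G zero

glue-OAT : ∀ {m k} {A : Graph m} {B : Graph k} b → OAT A → OAT B → OAT (glue A B (λ _ _ → b))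
glue-OAT false oa ob = union oa ob
glue-OAT true  oa ob = joined oa ob

left-bound : ∀ {m k N} → m + k ≡ suc N → Fin k → m ≤ N
left-bound {m} {suc k} eq _ = subst (m ≤_) (suc-injective (trans (sym (+-suc m k)) eq)) (m≤m+n m k)

right-bound : ∀ {m k N} → m + k ≡ suc N → Fin m → k ≤ N
right-bound {m} {k} eq = left-bound (trans (+-comm k m) eq)

induced-OAT : ∀ {n N m} → WfRec _<_ IsOAT n → (G : Graph N) → P4Sparse G →
  (g : Fin m → Fin N) → Injective _≡_ _≡_ g → Fin m → m ≤ n → OAT (induced G g)
induced-OAT {m = suc _} ih G sp g g-inj _ m≤n = ih m≤n (induced G g) (induced-P4Sparse G g g-inj sp)

split-OAT : ∀ {n b} → WfRec _<_ IsOAT (suc n) → (G : Graph (suc (suc n))) → P4Sparse G →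
  Split G b → OAT G
split-OAT {b = b} ih G sp (mkSplit side (x , sx) (y , sy) cross) =
  iso (glue-OAT b left-OAT right-OAT) (partition-iso G P cross)
  where
  P : Partition side
  P = partition side
  open Partition P
  left-OAT : OAT (left-part G P)
  left-OAT = induced-OAT ih G sp _ (λ e → inj₁-injective (vertex-injective e))
               (true-index x sx) (left-bound size (false-index y sy))
  right-OAT : OAT (right-part G P)
  right-OAT = induced-OAT ih G sp _ (λ e → inj₂-injective (vertex-injective e))
                (false-index y sy) (right-bound size (true-index x sx))

P4-OAT : ∀ {n} → IsOAT n → (G : Graph (suc (suc n))) → P4Sparse G →
  ∀ {a b c d} → InducedP4 G a b c d → OAT G
P4-OAT ih G sp {a} {c = c} P = iso (comparable G-a-OAT (punchOut a≢c) (neighbourhood G a) N[a]⊆N[c])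
                                   (deletion-iso G a)
  where
  a≢c : a ≢ c
  a≢c = P4-a≢c G P
  G-a-OAT : OAT (G ─ a)
  G-a-OAT = ih (G ─ a) (induced-P4Sparse G (punchIn a) (punchIn-injective a _ _) sp)
  N[a]⊆N[c] : ∀ x → neighbourhood G a x ≡ true → Edge (G ─ a) (punchOut a≢c) x
  N[a]⊆N[c] x ax = subst (λ z → Edge G z (punchIn a x)) (sym (punchIn-punchOut a≢c))
                     (endpoint-comparable G sp P (punchIn a x) ax)

oat-step : ∀ n → WfRec _<_ IsOAT n → IsOAT n
oat-step zero    _  G _  = iso single (K1-iso G)
oat-step (suc n) ih G sp with findP4 G
... | yes (_ , _ , _ , _ , P) = P4-OAT (ih ≤-refl) G sp P
... | no no-P4 = split-OAT ih G sp (proj₂ (P4-free-split n G λ a b c d P → no-P4 (a , b , c , d , P)))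

lemma1 : ∀ (n : ℕ) (G : Graph (suc n)) → P4Sparse G → OAT G
lemma1 = <-rec IsOAT oat-step
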